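{- In the game \textsc{saliquant}, $\mathcal{SG}(n)\geq \frac{n-2}{4}$ for every positive integer $n$.
   Context: \textsc{saliquant} is the normal-play impartial game whose positions are the positive integers, where the options of a position $n\geq 1$ are $\{n-k : 1\leq k\leq n,\ k\nmid n\}$. The nim-value is defined recursively by $\mathcal{SG}(n)=\operatorname{mex}\{\mathcal{SG}(x) : x \text{ an option of } n\}$, where $\operatorname{mex}(A)$ is the least nonnegative integer not in $A$. -}

module Defs where

open import Data.Nat using (ℕ; zero; suc; _∸_; _≤?_)
open import Data.Nat.Divisibility using (_∣?_)
open import Data.List using (List; []; _∷_; length; lookup; reverse; filterᵇ; map)
open import Data.List.Membership.DecPropositional (Data.Nat._≟_) using (_∈?_)
open import Data.Bool using (Bool; true; false; not)
open import Relation.Nullary.Decidable using (⌊_⌋; yes; no)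

-- mex of a finite list of naturals: least m not in the list.
-- Searches m = 0, 1, ..., length l (the answer is always ≤ length l).
mexFrom : ℕ → ℕ → List ℕ → ℕ
mexFrom m zero      l = m
mexFrom m (suc fuel) l with m ∈? l
... | yes _ = mexFrom (suc m) fuel l
... | no _ = m

mex : List ℕ → ℕ
mex l = mexFrom 0 (length l) l

-- Moves from position n: to n ∸ k for 1 ≤ k ≤ n with k ∤ n.
-- allowedKs n lists such k.
range1 : ℕ → List ℕ
range1 zero    = []
range1 (suc n) = reverse (suc n ∷ reverse (range1 n))

allowedKs : ℕ → List ℕ
allowedKs n = filterᵇ (λ k → not ⌊ k ∣? n ⌋) (range1 n)

-- sgTable n = [SG n, SG (n-1), ..., SG 0]  (SG 0 = 0 as a dummy value;
-- position 0 is never reached as an option since k = n always divides n).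
-- Entry for x ≤ n is at index n ∸ x.
lookupD : List ℕ → ℕ → ℕ
lookupD []       _       = 0
lookupD (x ∷ xs) zero    = x
lookupD (x ∷ xs) (suc i) = lookupD xs i

sgTable : ℕ → List ℕ
sgTable zero    = 0 ∷ []
sgTable (suc n) = mex (map (λ k → lookupD t (n ∸ (suc n ∸ k))) (allowedKs (suc n))) ∷ t
  where t = sgTable n

SG : ℕ → ℕ
SG n = lookupD (sgTable n) 0

-- Every move n ↦ n − k has 2 ≤ k < n (k = 1 and k = n divide n), so by induction
-- 2·SG n ≤ n − 1.  The odd position 2m + 1 has the options 2v + 1 for all v < m
-- (an even k never divides an odd number), hence SG (2m + 1) = m.  Any x with
-- 0 < x and 2x < n is an option of n, since k = n − x exceeds x and so cannot divide
-- x + k.  Taking x = 2v + 1, every v with 4v + 2 < n is the value of an option of n;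
-- if n > 4·SG n + 2 this would include SG n itself.
module Submission where

open import Defs
open import Data.Nat using (ℕ; _≤_; _+_; _*_; NonZero)
open import Data.Nat using (zero; suc; pred; _∸_; _<_; z≤n; s≤s; s≤s⁻¹; _≤?_)
open import Data.Nat.Properties
open import Data.Nat.Divisibility using (_∣_; ∣-refl; ∣-trans; 1∣_; m∣m*n; ∣1⇒≡1; ∣⇒≤; ∣m+n∣m⇒∣n)
open import Data.Nat.Induction using (<-rec)
open import Data.Nat.Tactic.RingSolver using (solve-∀)
open import Data.List using (List; _∷_; length; lookup; reverse; map)
open import Data.List.Properties using (map-cong-local)
open import Data.List.Membership.Propositional using (_∈_; _∉_)
open import Data.List.Membership.Propositional.Properties using (∈-map⁺; ∈-map⁻; ∈-filter⁺; ∈-filter⁻)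
open import Data.List.Membership.DecPropositional (Data.Nat._≟_) using (_∈?_)
open import Data.List.Relation.Unary.Any using (here; there; index)
open import Data.List.Relation.Unary.Any.Properties using (lookup-index; reverse⁺; reverse⁻)
import Data.List.Relation.Unary.All as All
open import Data.Fin using (toℕ)
import Data.Fin.Properties as Fin
open import Data.Sum using (inj₁; inj₂)
open import Data.Product using (∃; _×_; _,_; proj₁)
open import Function using (_∘_)
open import Relation.Nullary using (¬_; yes; no; contradiction)
open import Relation.Nullary.Decidable using (toWitnessFalse; fromWitnessFalse)
open import Relation.Binary.PropositionalEquality using (_≡_; refl; sym; trans; cong; subst)

length-≥-of-⊇-below : ∀ J (l : List ℕ) → (∀ {v} → v < J → v ∈ l) → J ≤ length l
length-≥-of-⊇-below J l below with J ≤? length l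
... | yes J≤∣l∣ = J≤∣l∣
... | no J≰∣l∣ with i , j , i<j , same ← Fin.pigeonhole (≰⇒> J≰∣l∣) (λ i → index (below (Fin.toℕ<n i))) =
  contradiction (Fin.toℕ-injective (trans (lookup-index (below (Fin.toℕ<n i)))
                                 (trans (cong (lookup l) same) (sym (lookup-index (below (Fin.toℕ<n j)))))))
                (Fin.<⇒≢ i<j)

below-suc : ∀ {m} {l : List ℕ} → (∀ {v} → v < m → v ∈ l) → m ∈ l → ∀ {v} → v < suc m → v ∈ l
below-suc below m∈l v<1+m with m<1+n⇒m<n∨m≡n v<1+m
... | inj₁ v<m = below v<m
... | inj₂ refl = m∈l

mexFrom-below-∈ : ∀ m fuel l → (∀ {v} → v < m → v ∈ l) → ∀ {v} → v < mexFrom m fuel l → v ∈ l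
mexFrom-below-∈ m zero l below = below
mexFrom-below-∈ m (suc fuel) l below with m ∈? l
... | no _ = below
... | yes m∈l = mexFrom-below-∈ (suc m) fuel l (below-suc below m∈l)

-- The fuel length l suffices: once m reaches length l, all of 0, …, m − 1 lie in l,
-- so m itself cannot (pigeonhole).
mexFrom-∉ : ∀ m fuel l → (∀ {v} → v < m → v ∈ l) → length l ≤ m + fuel → mexFrom m fuel l ∉ l
mexFrom-∉ m zero l below ∣l∣≤m m∈l =
  1+n≰n (≤-trans (length-≥-of-⊇-below (suc m) l (below-suc below m∈l)) (subst (length l ≤_) (+-identityʳ m) ∣l∣≤m))
mexFrom-∉ m (suc fuel) l below ∣l∣≤m+fuel with m ∈? l
... | no m∉l = m∉l
... | yes m∈l = mexFrom-∉ (suc m) fuel l (below-suc below m∈l) (subst (length l ≤_) (+-suc m fuel) ∣l∣≤m+fuel)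

<mex⇒∈ : ∀ l {v} → v < mex l → v ∈ l
<mex⇒∈ l = mexFrom-below-∈ 0 (length l) l (λ ())

mex∉ : ∀ l → mex l ∉ l
mex∉ l = mexFrom-∉ 0 (length l) l (λ ()) ≤-refl

mex-≥ : ∀ J l → (∀ {v} → v < J → v ∈ l) → J ≤ mex l
mex-≥ J l below = ≮⇒≥ (λ mex<J → mex∉ l (below mex<J))

lookupD-sgTable : ∀ n {x} → x ≤ n → lookupD (sgTable n) (n ∸ x) ≡ SG x
lookupD-sgTable n {x} x≤n with m≤n⇒m<n∨m≡n x≤n
lookupD-sgTable n       _ | inj₂ refl = cong (lookupD (sgTable n)) (n∸n≡0 n)
lookupD-sgTable (suc n) _ | inj₁ (s≤s x≤n) =
  trans (cong (lookupD (sgTable (suc n))) (+-∸-assoc 1 x≤n)) (lookupD-sgTable n x≤n)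

∈-range1⁺ : ∀ {n k} → 1 ≤ k → k ≤ n → k ∈ range1 n
∈-range1⁺ {zero}  (s≤s _) ()
∈-range1⁺ {suc n} 1≤k k≤1+n with m≤n⇒m<n∨m≡n k≤1+n
... | inj₂ refl = reverse⁺ {xs = suc n ∷ reverse (range1 n)} (here refl)
... | inj₁ (s≤s k≤n) = reverse⁺ {xs = suc n ∷ reverse (range1 n)} (there (reverse⁺ (∈-range1⁺ 1≤k k≤n)))

∈-range1⁻ : ∀ {n k} → k ∈ range1 n → 1 ≤ k × k ≤ n
∈-range1⁻ {suc n} k∈ with reverse⁻ {xs = suc n ∷ reverse (range1 n)} k∈
... | here refl = s≤s z≤n , ≤-refl
... | there k∈′ with 1≤k , k≤n ← ∈-range1⁻ (reverse⁻ {xs = range1 n} k∈′) = 1≤k , m≤n⇒m≤1+n k≤n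

∈-allowedKs⁺ : ∀ {n k} → 1 ≤ k → k ≤ n → ¬ k ∣ n → k ∈ allowedKs n
∈-allowedKs⁺ 1≤k k≤n k∤n = ∈-filter⁺ _ (∈-range1⁺ 1≤k k≤n) (fromWitnessFalse k∤n)

∈-allowedKs⁻ : ∀ {n k} → k ∈ allowedKs n → 1 ≤ k × k ≤ n × ¬ k ∣ n
∈-allowedKs⁻ k∈ with k∈range , k∤n ← ∈-filter⁻ _ k∈ with 1≤k , k≤n ← ∈-range1⁻ k∈range =
  1≤k , k≤n , toWitnessFalse k∤n

optionSGs : ℕ → List ℕ
optionSGs n = map (λ k → SG (n ∸ k)) (allowedKs n)

SG-suc : ∀ n → SG (suc n) ≡ mex (optionSGs (suc n))
SG-suc n = cong mex (map-cong-local (All.tabulate λ k∈ →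
  lookupD-sgTable n (target≤n (proj₁ (∈-allowedKs⁻ {suc n} k∈)))))
  where
  target≤n : ∀ {k} → 1 ≤ k → suc n ∸ k ≤ n
  target≤n {suc k} _ = m∸n≤m n k

move-bounds : ∀ {n k} → 1 ≤ k → k ≤ n → ¬ k ∣ n → 2 ≤ k × k < n
move-bounds {n} {suc zero} _ _ 1∤n = contradiction (1∣ n) 1∤n
move-bounds {n} {suc (suc k)} _ k≤n k∤n with m≤n⇒m<n∨m≡n k≤n
... | inj₁ k<n = s≤s (s≤s z≤n) , k<n
... | inj₂ refl = contradiction ∣-refl k∤n

∈-optionSGs⁻ : ∀ {n y} → y ∈ optionSGs n → ∃ λ x → 0 < x × 2 + x ≤ n × y ≡ SG x
∈-optionSGs⁻ {n} y∈ with k , k∈ , refl ← ∈-map⁻ _ y∈ with 1≤k , k≤n , k∤n ← ∈-allowedKs⁻ k∈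
  with 2≤k , k<n ← move-bounds 1≤k k≤n k∤n =
  n ∸ k , m<n⇒0<n∸m k<n , ≤-trans (+-monoˡ-≤ (n ∸ k) 2≤k) (≤-reflexive (m+[n∸m]≡n k≤n)) , refl

∈-optionSGs⁺ : ∀ x {k} → 1 ≤ k → ¬ k ∣ x + k → SG x ∈ optionSGs (x + k)
∈-optionSGs⁺ x {k} 1≤k k∤ =
  subst (_∈ optionSGs (x + k)) (cong SG (m+n∸n≡m x k)) (∈-map⁺ _ (∈-allowedKs⁺ 1≤k (m≤n+m k x) k∤))

even∤odd : ∀ c m → ¬ 2 * c ∣ suc (2 * m)
even∤odd c m 2c∣odd = contradiction (∣1⇒≡1 (∣m+n∣m⇒∣n 2∣2m+1 (m∣m*n m))) λ ()
  where
  2∣2m+1 : 2 ∣ 2 * m + 1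
  2∣2m+1 = subst (2 ∣_) (+-comm 1 (2 * m)) (∣-trans (m∣m*n c) 2c∣odd)

∤-of-<-summand : ∀ {x k} → 0 < x → x < k → ¬ k ∣ x + k
∤-of-<-summand {suc x} {k} _ x<k k∣x+k =
  <⇒≱ x<k (∣⇒≤ (∣m+n∣m⇒∣n (subst (k ∣_) (+-comm (suc x) k) k∣x+k) ∣-refl))

SG-upper : ∀ n → 2 * SG n ≤ pred n
SG-upper = <-rec _ bound
  where
  bound : ∀ n → (∀ {x} → x < n → 2 * SG x ≤ pred x) → 2 * SG n ≤ pred n
  bound zero    _  = z≤n
  bound (suc n) ih with SG (suc n) in eq
  ... | zero  = z≤n
  ... | suc m with ∈-optionSGs⁻ (<mex⇒∈ _ (subst (m <_) (trans (sym eq) (SG-suc n)) ≤-refl))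
  ... | suc x , _ , 3+x≤1+n , refl = begin
    2 * suc (SG (suc x)) ≡⟨ *-suc 2 (SG (suc x)) ⟩
    2 + 2 * SG (suc x)   ≤⟨ +-monoʳ-≤ 2 (ih (≤-trans (n≤1+n _) 3+x≤1+n)) ⟩
    2 + x                ≤⟨ s≤s⁻¹ 3+x≤1+n ⟩
    n                    ∎
    where open ≤-Reasoning

SG-odd : ∀ m → SG (suc (2 * m)) ≡ m
SG-odd = <-rec _ λ m ih → ≤-antisym (*-cancelˡ-≤ 2 (SG-upper (suc (2 * m)))) (lower m ih)
  where
  odd-split : ∀ v d → suc (2 * v) + 2 * suc d ≡ suc (2 * (suc v + d))
  odd-split = solve-∀

  odd-option : ∀ {v m} → v < m → SG (suc (2 * v)) ∈ optionSGs (suc (2 * m))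
  odd-option {v} v<m with d , refl ← m≤n⇒∃[o]m+o≡n v<m =
    subst (λ n → SG (suc (2 * v)) ∈ optionSGs n) (odd-split v d)
      (∈-optionSGs⁺ (suc (2 * v)) (s≤s z≤n)
        (subst (¬_ ∘ (2 * suc d ∣_)) (sym (odd-split v d)) (even∤odd (suc d) (suc v + d))))

  lower : ∀ m → (∀ {v} → v < m → SG (suc (2 * v)) ≡ v) → m ≤ SG (suc (2 * m))
  lower m ih = subst (m ≤_) (sym (SG-suc (2 * m)))
    (mex-≥ m _ λ v<m → subst (_∈ optionSGs (suc (2 * m))) (ih v<m) (odd-option v<m))

small-option : ∀ {x n} → 0 < x → x + x < n → SG x ∈ optionSGs n
small-option {x} {n} 0<x x+x<n =
  subst (λ m → SG x ∈ optionSGs m) (m+[n∸m]≡n (≤-trans (m≤m+n x x) (<⇒≤ x+x<n)))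
    (∈-optionSGs⁺ x (≤-trans 0<x (<⇒≤ x<n∸x)) (∤-of-<-summand 0<x x<n∸x))
  where
  x<n∸x : x < n ∸ x
  x<n∸x = m+n≤o⇒m≤o∸n (suc x) x+x<n

SG-lower : ∀ {n v} → 4 * v + 2 < n → v < SG n
SG-lower {suc n} {v} 4v+2<1+n = subst (v <_) (sym (SG-suc n)) (mex-≥ (suc v) _ odd-options)
  where
  double-odd : ∀ u → suc (2 * u) + suc (2 * u) ≡ 4 * u + 2
  double-odd = solve-∀

  odd-options : ∀ {u} → u < suc v → u ∈ optionSGs (suc n)
  odd-options {u} u<1+v = subst (_∈ optionSGs (suc n)) (SG-odd u) (small-option (s≤s z≤n) (begin-strict
    suc (2 * u) + suc (2 * u) ≡⟨ double-odd u ⟩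
    4 * u + 2                 ≤⟨ +-monoˡ-≤ 2 (*-monoʳ-≤ 4 (s≤s⁻¹ u<1+v)) ⟩
    4 * v + 2                 <⟨ 4v+2<1+n ⟩
    suc n                     ∎))
    where open ≤-Reasoning

-- The bound also holds at n = 0.
mainTheorem7 : (n : ℕ) → .{{_ : NonZero n}} → n ≤ 4 * SG n + 2
mainTheorem7 n = ≮⇒≥ λ 4s+2<n → <-irrefl refl (SG-lower 4s+2<n)
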